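{- For every integer $n\ge1$, $$\mathrm{pk}_n(312,321)=n!\sum_{k=1}^n\frac{\binom{n-1}{k-1}}{k!}.$$
   Context: For a positive integer $n$, $[n]=\{1,\dots,n\}$. A function $f:[n]\to[n]$ is a parking function if for every $i\in[n]$, $|\{j\in[n]: f(j)\le i\}|\ge i$ (equivalently, in the usual car-parking process where car $i$ prefers spot $f(i)$ and takes the first free spot at or after it, all cars park). The parking permutation $\rho_f\in S_n$ is defined by: spot $i$ is occupied by car $\rho_f(i)$. A permutation $\pi\in S_n$ contains $\sigma\in S_m$ as a pattern if there exist $1\le i_1<\dots<i_m\le n$ with $\pi(i_a)<\pi(i_b)$ iff $\sigma(a)<\sigma(b)$ for all $a,b$; otherwise it avoids $\sigma$. $\mathrm{pk}_n(\sigma_1,\dots,\sigma_k)$ is the number of parking functions $f:[n]\to[n]$ with $\rho_f$ avoiding every $\sigma_i$. -}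

module Defs where

open import Data.Nat using (ℕ; zero; suc; _∸_; _<ᵇ_; _≤?_; _≤_)
open import Data.Bool using (Bool; true; false; _∧_; not; if_then_else_)
open import Data.Bool.Properties using () renaming (_≟_ to _≟ᵇ_)
open import Data.Fin using (Fin; toℕ)

open import Data.Vec using (Vec; []; _∷_; toList)
open import Data.Maybe using (Maybe; just; nothing)
open import Data.List using (List; []; _∷_; map; concatMap; length; foldl; zip; filter; catMaybes; applyUpTo; allFin)

open import Data.Product using (_×_; _,_)
open import Data.Bool.ListAction using (all; any)
open import Relation.Nullary.Decidable using (⌊_⌋)
open import Relation.Binary.PropositionalEquality using (_≡_)

-- Conventions: spots and cars are numbered 1..n (as natural numbers).
-- A function f : [n] → [n] is represented as a vector  f : Vec (Fin n) n,
-- where the j-th entry (j = 0..n-1, i.e. car j+1) is  f(j+1) - 1  as an element of Fin n.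

val : ∀ {n} → Fin n → ℕ
val i = suc (toℕ i)

allVecs : ∀ {A : Set} (k : ℕ) → List A → List (Vec A k)
allVecs zero    xs = [] ∷ []
allVecs (suc k) xs = concatMap (λ x → map (x ∷_) (allVecs k xs)) xs

allFuns : (n : ℕ) → List (Vec (Fin n) n)
allFuns n = allVecs n (allFin n)

isParking : ∀ {n} → Vec (Fin n) n → Bool
isParking {n} f =
  all (λ i → ⌊ i ≤? length (filter (λ v → val v ≤? i) (toList f)) ⌋) (applyUpTo suc n)

-- The state is the list of spots 1..n, each either empty
-- (nothing) or occupied by a car (just c).
-- placeFrom c s spots: car c skips the first s spots, then takes the first
-- free spot; if there is none, the car does not park (state unchanged).
placeFrom : ℕ → ℕ → List (Maybe ℕ) → List (Maybe ℕ)
placeFrom c s       []              = []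
placeFrom c (suc s) (x ∷ xs)        = x ∷ placeFrom c s xs
placeFrom c zero    (nothing ∷ xs)  = just c ∷ xs
placeFrom c zero    (just d ∷ xs)   = just d ∷ placeFrom c zero xs

park : ℕ → ℕ → List (Maybe ℕ) → List (Maybe ℕ)
park c p = placeFrom c (p ∸ 1)

emptySpots : ℕ → List (Maybe ℕ)
emptySpots zero    = []
emptySpots (suc n) = nothing ∷ emptySpots n

parkingOutcome : ∀ {n} → Vec (Fin n) n → List (Maybe ℕ)
parkingOutcome {n} f =
  foldl (λ st cp → park (Data.Product.proj₁ cp) (Data.Product.proj₂ cp) st)
        (emptySpots n)
        (zip (applyUpTo suc n) (map val (toList f)))

-- parking permutation ρ_f in one-line notation: ρ_f(i) = car in spot i
-- (for a parking function every spot is occupied, so nothing is dropped)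
parkingPerm : ∀ {n} → Vec (Fin n) n → List ℕ
parkingPerm f = catMaybes (parkingOutcome f)

subseqs : ∀ {A : Set} → List A → List (List A)
subseqs []       = [] ∷ []
subseqs (x ∷ xs) = map (x ∷_) (subseqs xs) Data.List.++ subseqs xs

orderIso : List ℕ → List ℕ → Bool
orderIso []       []       = true
orderIso (x ∷ xs) (y ∷ ys) =
  all (λ p → ⌊ (x <ᵇ Data.Product.proj₁ p) ≟ᵇ (y <ᵇ Data.Product.proj₂ p) ⌋
           ∧ ⌊ (Data.Product.proj₁ p <ᵇ x) ≟ᵇ (Data.Product.proj₂ p <ᵇ y) ⌋)
      (zip xs ys)
  ∧ orderIso xs ys
orderIso _        _        = false

contains : List ℕ → List ℕ → Bool
contains π σ = any (λ s → orderIso s σ) (subseqs π)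

avoidsAll : List ℕ → List (List ℕ) → Bool
avoidsAll π σs = all (λ σ → not (contains π σ)) σs

pk : ℕ → List (List ℕ) → ℕ
pk n σs = length (filter (λ f → (isParking f ∧ avoidsAll (parkingPerm f) σs) ≟ᵇ true) (allFuns n))

-- A permutation avoids 312 and 321 exactly when no entry has two smaller entries to its
-- right. Cars arrive in increasing order, so the car that eventually fills an empty spot is
-- larger than every car already parked after it: at most one car may park beyond the first
-- gap. The states from which the parking process can still succeed are therefore a filled
-- prefix followed by empty spots, or a filled prefix, a gap, one car and empty spots, and
-- counting preferences from them gives a recurrence for pk_n(312, 321). Read spot by spot it
-- becomes the two-term recursion C(m+1) = (m+1) C(m) + O(m), O(m+1) = (m+1) (C(m) + O(m)),
-- and splitting C(m+1) into rows gives terms with the closed form (m+1)! binom(m, j) / (j+1)!.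
module Submission where

module BoundedSums where
  open import Data.Nat using (ℕ; zero; suc; _+_; _*_; _<_; z<s; s<s)
  open import Data.Nat.Properties using (+-assoc; +-identityʳ; *-zeroʳ; *-distribˡ-+)
  open import Data.Nat.Tactic.RingSolver using (solve-∀)
  open import Relation.Binary.PropositionalEquality using (_≡_; refl; sym; trans; cong; cong₂)

  sumBelow : ℕ → (ℕ → ℕ) → ℕ
  sumBelow zero    f = 0
  sumBelow (suc n) f = f 0 + sumBelow n (λ i → f (suc i))

  syntax sumBelow n (λ i → e) = ∑[ i < n ] e

  ∑-cong : ∀ n {f g : ℕ → ℕ} → (∀ i → i < n → f i ≡ g i) → ∑[ i < n ] f i ≡ ∑[ i < n ] g i
  ∑-cong zero    eq = refl
  ∑-cong (suc n) eq = cong₂ _+_ (eq 0 z<s) (∑-cong n (λ i i<n → eq (suc i) (s<s i<n)))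

  ∑-const : ∀ n {f : ℕ → ℕ} c → (∀ i → i < n → f i ≡ c) → ∑[ i < n ] f i ≡ n * c
  ∑-const zero    c eq = refl
  ∑-const (suc n) c eq = cong₂ _+_ (eq 0 z<s) (∑-const n c (λ i i<n → eq (suc i) (s<s i<n)))

  ∑-zero : ∀ n {f : ℕ → ℕ} → (∀ i → i < n → f i ≡ 0) → ∑[ i < n ] f i ≡ 0
  ∑-zero n eq = trans (∑-const n 0 eq) (*-zeroʳ n)

  ∑-distrib-+ : ∀ n (f g : ℕ → ℕ) → ∑[ i < n ] (f i + g i) ≡ ∑[ i < n ] f i + ∑[ i < n ] g i
  ∑-distrib-+ zero    f g = refl
  ∑-distrib-+ (suc n) f g =
    trans (cong (f 0 + g 0 +_) (∑-distrib-+ n (λ i → f (suc i)) (λ i → g (suc i))))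
          (interchange (f 0) (g 0) _ _)
    where
    interchange : ∀ a b c d → (a + b) + (c + d) ≡ (a + c) + (b + d)
    interchange = solve-∀

  *-distribˡ-∑ : ∀ n a (f : ℕ → ℕ) → a * ∑[ i < n ] f i ≡ ∑[ i < n ] (a * f i)
  *-distribˡ-∑ zero    a f = *-zeroʳ a
  *-distribˡ-∑ (suc n) a f =
    trans (*-distribˡ-+ a (f 0) _) (cong (a * f 0 +_) (*-distribˡ-∑ n a (λ i → f (suc i))))

  ∑-split : ∀ m n (f : ℕ → ℕ) → ∑[ i < m + n ] f i ≡ ∑[ i < m ] f i + ∑[ i < n ] f (m + i)
  ∑-split zero    n f = refl
  ∑-split (suc m) n f = trans (cong (f 0 +_) (∑-split m n (λ i → f (suc i)))) (sym (+-assoc (f 0) _ _))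

  ∑-last : ∀ n (f : ℕ → ℕ) → ∑[ i < suc n ] f i ≡ ∑[ i < n ] f i + f n
  ∑-last zero    f = +-identityʳ (f 0)
  ∑-last (suc n) f = trans (cong (f 0 +_) (∑-last n (λ i → f (suc i)))) (sym (+-assoc (f 0) _ _))

  ∑-constPrefix : ∀ {n} p m {v} (f g : ℕ → ℕ) → n ≡ p + m → (∀ i → i < p → f i ≡ v) →
                  (∀ i → i < m → f (p + i) ≡ g i) → ∑[ i < n ] f i ≡ p * v + ∑[ i < m ] g i
  ∑-constPrefix p m f g refl f≡v f≡g = trans (∑-split p m f) (cong₂ _+_ (∑-const p _ f≡v) (∑-cong m f≡g))

  ∑-extend : ∀ n (f : ℕ → ℕ) → f n ≡ 0 → ∑[ i < suc n ] f i ≡ ∑[ i < n ] f i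
  ∑-extend n f fn≡0 = trans (∑-last n f) (trans (cong (∑[ i < n ] f i +_) fn≡0) (+-identityʳ _))

module Binomial where
  open import Data.Nat using (zero; suc; _+_; _*_)
  open import Data.Nat.Properties using (+-assoc; +-comm; +-identityʳ; *-identityʳ; *-zeroʳ; *-distribˡ-+)
  open import Data.Nat.Combinatorics using (_C_; nCk+nC[k+1]≡[n+1]C[k+1]; nC1≡n)
  open import Data.Nat.Tactic.RingSolver using (solve-∀)
  open import Relation.Binary.PropositionalEquality using (_≡_; refl; sym; trans; cong; cong₂; module ≡-Reasoning)

  [k+1]*[n+1]C[k+1]≡[n+1]*nCk : ∀ n k → suc k * (suc n C suc k) ≡ suc n * (n C k)
  [k+1]*[n+1]C[k+1]≡[n+1]*nCk zero    zero    = refl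
  [k+1]*[n+1]C[k+1]≡[n+1]*nCk zero    (suc k) = *-zeroʳ (suc (suc k))
  [k+1]*[n+1]C[k+1]≡[n+1]*nCk (suc n) zero    =
    trans (+-identityʳ _) (trans (nC1≡n (suc (suc n))) (sym (*-identityʳ (suc (suc n)))))
  [k+1]*[n+1]C[k+1]≡[n+1]*nCk (suc n) (suc k) = begin
      suc (suc k) * (suc (suc n) C suc (suc k))
    ≡⟨ cong (suc (suc k) *_) (sym (nCk+nC[k+1]≡[n+1]C[k+1] (suc n) (suc k))) ⟩
      suc (suc k) * (a + b)
    ≡⟨ regroup k a b ⟩
      a + (suc k * a + suc (suc k) * b)
    ≡⟨ cong₂ (λ x y → a + (x + y)) ([k+1]*[n+1]C[k+1]≡[n+1]*nCk n k) ([k+1]*[n+1]C[k+1]≡[n+1]*nCk n (suc k)) ⟩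
      a + (suc n * (n C k) + suc n * (n C suc k))
    ≡⟨ cong (a +_) (sym (*-distribˡ-+ (suc n) (n C k) (n C suc k))) ⟩
      a + suc n * (n C k + n C suc k)
    ≡⟨ cong (λ x → a + suc n * x) (nCk+nC[k+1]≡[n+1]C[k+1] n k) ⟩
      suc (suc n) * (suc n C suc k) ∎
    where
    open ≡-Reasoning
    a = suc n C suc k
    b = suc n C suc (suc k)
    regroup : ∀ k a b → suc (suc k) * (a + b) ≡ a + (suc k * a + suc (suc k) * b)
    regroup = solve-∀

  [n+1]*nC[k+1]+[k+2]*[n+1]C[k+1]≡[n+2]*[n+1]C[k+1] : ∀ n k →
    suc n * (n C suc k) + suc (suc k) * (suc n C suc k) ≡ suc (suc n) * (suc n C suc k)
  [n+1]*nC[k+1]+[k+2]*[n+1]C[k+1]≡[n+2]*[n+1]C[k+1] n k = begin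
      suc n * b + suc (suc k) * c
    ≡⟨ sym (+-assoc (suc n * b) c (suc k * c)) ⟩
      suc n * b + c + suc k * c
    ≡⟨ cong (suc n * b + c +_) ([k+1]*[n+1]C[k+1]≡[n+1]*nCk n k) ⟩
      suc n * b + c + suc n * a
    ≡⟨ regroup (suc n) a b c ⟩
      suc n * (a + b) + c
    ≡⟨ cong (λ x → suc n * x + c) (nCk+nC[k+1]≡[n+1]C[k+1] n k) ⟩
      suc n * c + c
    ≡⟨ +-comm (suc n * c) c ⟩
      suc (suc n) * c ∎
    where
    open ≡-Reasoning
    a = n C k
    b = n C suc k
    c = suc n C suc k
    regroup : ∀ m a b c → m * b + c + m * a ≡ m * (a + b) + c
    regroup = solve-∀

module Weights where
  open import Data.Nat using (ℕ; zero; suc; _+_; _*_; _∸_; _<_; _!; s<s)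
  open import Data.Nat.Properties using (+-comm; +-suc; +-identityʳ; *-identityˡ; *-identityʳ; *-zeroʳ; *-distribˡ-+; n<1+n; m<n⇒m<1+n)
  open import Data.Nat.Combinatorics using (_C_; nCk+nC[k+1]≡[n+1]C[k+1])
  open import Data.Nat.Tactic.RingSolver using (solve-∀)
  open import Data.Product using (_×_; _,_; proj₁; proj₂)
  open import Relation.Binary.PropositionalEquality using (_≡_; refl; sym; cong; cong₂; module ≡-Reasoning)
  open BoundedSums
  open Binomial

  -- An avoiding parking permutation is a concatenation of blocks k+2 … k+ℓ (k+1), and the
  -- entry in spot i (1-based) has i possible preferences, except the last entry of a block
  -- of length ℓ ≥ 2, which has one. With these weights closedPrefix m and openPrefix m
  -- count the first m spots ending outside or inside a block, and closedSuffix p r and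
  -- openSuffix p r the r spots that follow such a prefix of p spots.
  closedPrefix openPrefix : ℕ → ℕ
  closedPrefix zero    = 1
  closedPrefix (suc m) = suc m * closedPrefix m + openPrefix m
  openPrefix zero    = 0
  openPrefix (suc m) = suc m * (closedPrefix m + openPrefix m)

  closedSuffix openSuffix : ℕ → ℕ → ℕ
  closedSuffix p zero    = 1
  closedSuffix p (suc r) = suc p * closedSuffix (suc p) r + suc p * openSuffix (suc p) r
  openSuffix p zero    = 0
  openSuffix p (suc r) = closedSuffix (suc p) r + suc p * openSuffix (suc p) r

  -- Completions of p filled spots, g + 1 empty spots, one parked car and r empty spots:
  -- the next g + 1 cars must fill the gap.
  gappedSuffix : ℕ → ℕ → ℕ → ℕ
  gappedSuffix p zero    r = suc p * closedSuffix (suc (suc p)) r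
  gappedSuffix p (suc g) r = suc p * gappedSuffix (suc p) g r

  ∑-gappedSuffix : ∀ p r → ∑[ g < r ] gappedSuffix p g (r ∸ suc g) ≡ suc p * openSuffix (suc p) r
  ∑-gappedSuffix p zero    = sym (*-zeroʳ (suc p))
  ∑-gappedSuffix p (suc r) = begin
      suc p * closedSuffix (suc (suc p)) r + ∑[ g < r ] (suc p * gappedSuffix (suc p) g (r ∸ suc g))
    ≡⟨ cong (suc p * closedSuffix (suc (suc p)) r +_) (sym (*-distribˡ-∑ r (suc p) _)) ⟩
      suc p * closedSuffix (suc (suc p)) r + suc p * ∑[ g < r ] gappedSuffix (suc p) g (r ∸ suc g)
    ≡⟨ cong (λ x → suc p * closedSuffix (suc (suc p)) r + suc p * x) (∑-gappedSuffix (suc p) r) ⟩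
      suc p * closedSuffix (suc (suc p)) r + suc p * (suc (suc p) * openSuffix (suc (suc p)) r)
    ≡⟨ sym (*-distribˡ-+ (suc p) (closedSuffix (suc (suc p)) r) (suc (suc p) * openSuffix (suc (suc p)) r)) ⟩
      suc p * openSuffix (suc p) (suc r) ∎
    where open ≡-Reasoning

  prefix-suffix : ∀ p r → closedPrefix p * closedSuffix p r + openPrefix p * openSuffix p r ≡ closedPrefix (p + r)
  prefix-suffix p zero    = begin
      closedPrefix p * 1 + openPrefix p * 0 ≡⟨ cong₂ _+_ (*-identityʳ (closedPrefix p)) (*-zeroʳ (openPrefix p)) ⟩
      closedPrefix p + 0                    ≡⟨ +-identityʳ _ ⟩
      closedPrefix p                        ≡⟨ cong closedPrefix (sym (+-identityʳ p)) ⟩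
      closedPrefix (p + 0)                  ∎
    where open ≡-Reasoning
  prefix-suffix p (suc r) = begin
      closedPrefix p * closedSuffix p (suc r) + openPrefix p * openSuffix p (suc r)
    ≡⟨ moveSpot (suc p) (closedPrefix p) (openPrefix p) (closedSuffix (suc p) r) (openSuffix (suc p) r) ⟩
      closedPrefix (suc p) * closedSuffix (suc p) r + openPrefix (suc p) * openSuffix (suc p) r
    ≡⟨ prefix-suffix (suc p) r ⟩
      closedPrefix (suc p + r)
    ≡⟨ cong closedPrefix (sym (+-suc p r)) ⟩
      closedPrefix (p + suc r) ∎
    where
    open ≡-Reasoning
    moveSpot : ∀ P C O A B → C * (P * A + P * B) + O * (A + P * B) ≡ (P * C + O) * A + (P * (C + O)) * B
    moveSpot = solve-∀

  closedSuffix-from-0 : ∀ n → closedSuffix 0 n ≡ closedPrefix n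
  closedSuffix-from-0 n = begin
      closedSuffix 0 n                 ≡⟨ sym (*-identityˡ _) ⟩
      1 * closedSuffix 0 n             ≡⟨ sym (+-identityʳ _) ⟩
      1 * closedSuffix 0 n + 0         ≡⟨ prefix-suffix 0 n ⟩
      closedPrefix n                   ∎
    where open ≡-Reasoning

  shift : (ℕ → ℕ) → ℕ → ℕ
  shift f zero    = 0
  shift f (suc j) = f j

  -- closedRow m j and openRow m j refine closedPrefix (m + 1) and openPrefix (m + 1);
  -- closedRow m j turns out to be the Lah number L(m + 1, j + 1).
  closedRow openRow : ℕ → ℕ → ℕ
  closedRow zero    zero    = 1
  closedRow zero    (suc j) = 0
  closedRow (suc m) j       = suc m * closedRow m j + openRow m j + shift (closedRow m) j
  openRow zero    zero    = 1
  openRow zero    (suc j) = 0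
  openRow (suc m) j       = suc (suc m) * (openRow m j + shift (closedRow m) j)

  rows-vanish : ∀ m j → m < j → closedRow m j ≡ 0 × openRow m j ≡ 0
  rows-vanish zero    (suc j) _ = refl , refl
  rows-vanish (suc m) (suc j) (s<s m<j)
    with rows-vanish m (suc j) (m<n⇒m<1+n m<j) | rows-vanish m j m<j
  ... | x≡0 , y≡0 | p≡0 , _ rewrite x≡0 | y≡0 | p≡0 =
    cong (λ x → x + 0 + 0) (*-zeroʳ (suc m)) , *-zeroʳ (suc (suc m))

  closedPrefix-∑ : ∀ m → closedPrefix (suc m) ≡ ∑[ j < suc m ] closedRow m j
  openPrefix-∑ : ∀ m → openPrefix (suc m) ≡ ∑[ j < suc m ] openRow m j

  closedPrefix-∑ zero    = refl
  closedPrefix-∑ (suc m) = begin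
      suc (suc m) * closedPrefix (suc m) + openPrefix (suc m)
    ≡⟨ cong₂ (λ x y → suc (suc m) * x + y) (closedPrefix-∑ m) (openPrefix-∑ m) ⟩
      suc (suc m) * X + Y
    ≡⟨ regroup m X Y ⟩
      suc m * X + Y + X
    ≡⟨ cong₂ (λ x y → suc m * x + y + X) (sym (∑-extend (suc m) (closedRow m) (proj₁ vanish)))
                                         (sym (∑-extend (suc m) (openRow m) (proj₂ vanish))) ⟩
      suc m * ∑[ j < suc (suc m) ] closedRow m j + ∑[ j < suc (suc m) ] openRow m j + X
    ≡⟨ cong (λ x → x + ∑[ j < suc (suc m) ] openRow m j + X) (*-distribˡ-∑ (suc (suc m)) (suc m) (closedRow m)) ⟩
      ∑[ j < suc (suc m) ] (suc m * closedRow m j) + ∑[ j < suc (suc m) ] openRow m j + X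
    ≡⟨ cong (_+ X) (sym (∑-distrib-+ (suc (suc m)) (λ j → suc m * closedRow m j) (openRow m))) ⟩
      ∑[ j < suc (suc m) ] (suc m * closedRow m j + openRow m j) + X
    ≡⟨ sym (∑-distrib-+ (suc (suc m)) (λ j → suc m * closedRow m j + openRow m j) (shift (closedRow m))) ⟩
      ∑[ j < suc (suc m) ] closedRow (suc m) j ∎
    where
    open ≡-Reasoning
    X = ∑[ j < suc m ] closedRow m j
    Y = ∑[ j < suc m ] openRow m j
    vanish = rows-vanish m (suc m) (n<1+n m)
    regroup : ∀ m x y → suc (suc m) * x + y ≡ suc m * x + y + x
    regroup = solve-∀

  openPrefix-∑ zero    = refl
  openPrefix-∑ (suc m) = begin
      suc (suc m) * (closedPrefix (suc m) + openPrefix (suc m))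
    ≡⟨ cong₂ (λ x y → suc (suc m) * (x + y)) (closedPrefix-∑ m) (openPrefix-∑ m) ⟩
      suc (suc m) * (X + Y)
    ≡⟨ cong (suc (suc m) *_) (+-comm X Y) ⟩
      suc (suc m) * (Y + X)
    ≡⟨ cong (λ y → suc (suc m) * (y + X)) (sym (∑-extend (suc m) (openRow m) (proj₂ vanish))) ⟩
      suc (suc m) * (∑[ j < suc (suc m) ] openRow m j + X)
    ≡⟨ cong (suc (suc m) *_) (sym (∑-distrib-+ (suc (suc m)) (openRow m) (shift (closedRow m)))) ⟩
      suc (suc m) * ∑[ j < suc (suc m) ] (openRow m j + shift (closedRow m) j)
    ≡⟨ *-distribˡ-∑ (suc (suc m)) (suc (suc m)) (λ j → openRow m j + shift (closedRow m) j) ⟩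
      ∑[ j < suc (suc m) ] openRow (suc m) j ∎
    where
    open ≡-Reasoning
    X = ∑[ j < suc m ] closedRow m j
    Y = ∑[ j < suc m ] openRow m j
    vanish = rows-vanish m (suc m) (n<1+n m)

  closedRow-closedForm : ∀ m j → closedRow m j * suc j ! ≡ (m C j) * suc m !
  openRow-closedForm : ∀ m j → openRow m j * j ! ≡ (m C j) * suc m !

  closedRow-closedForm zero    zero     = refl
  closedRow-closedForm zero    (suc j)  = refl
  closedRow-closedForm (suc m) zero     = begin
      (suc m * X + Y + 0) * 1          ≡⟨ distribute (suc m) X Y ⟩
      suc m * (X * 1) + Y * 1
        ≡⟨ cong₂ (λ x y → suc m * x + y) (closedRow-closedForm m 0) (openRow-closedForm m 0) ⟩
      suc m * (1 * F) + 1 * F          ≡⟨ collect (suc m) F ⟩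
      1 * (suc (suc m) * F)            ∎
    where
    open ≡-Reasoning
    X = closedRow m 0
    Y = openRow m 0
    F = suc m !
    distribute : ∀ m x y → (m * x + y + 0) * 1 ≡ m * (x * 1) + y * 1
    distribute = solve-∀
    collect : ∀ m f → m * (1 * f) + 1 * f ≡ 1 * (suc m * f)
    collect = solve-∀
  closedRow-closedForm (suc m) (suc j) = begin
      (suc m * X + Y + P) * (suc (suc j) * G)
    ≡⟨ distribute (suc m) (suc (suc j)) X Y P G ⟩
      suc m * (X * (suc (suc j) * G)) + suc (suc j) * (Y * G) + suc (suc j) * (P * G)
    ≡⟨ cong₂ (λ x y → suc m * x + suc (suc j) * y + suc (suc j) * (P * G))
             (closedRow-closedForm m (suc j)) (openRow-closedForm m (suc j)) ⟩
      suc m * (b * F) + suc (suc j) * (b * F) + suc (suc j) * (P * G)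
    ≡⟨ cong (λ z → suc m * (b * F) + suc (suc j) * (b * F) + suc (suc j) * z) (closedRow-closedForm m j) ⟩
      suc m * (b * F) + suc (suc j) * (b * F) + suc (suc j) * (a * F)
    ≡⟨ collect (suc m) (suc (suc j)) a b F ⟩
      (suc m * b + suc (suc j) * (a + b)) * F
    ≡⟨ cong (λ z → (suc m * b + suc (suc j) * z) * F) (nCk+nC[k+1]≡[n+1]C[k+1] m j) ⟩
      (suc m * b + suc (suc j) * c) * F
    ≡⟨ cong (_* F) ([n+1]*nC[k+1]+[k+2]*[n+1]C[k+1]≡[n+2]*[n+1]C[k+1] m j) ⟩
      suc (suc m) * c * F
    ≡⟨ rearrange (suc (suc m)) c F ⟩
      c * (suc (suc m) * F) ∎
    where
    open ≡-Reasoning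
    X = closedRow m (suc j)
    Y = openRow m (suc j)
    P = closedRow m j
    G = suc j !
    F = suc m !
    a = m C j
    b = m C suc j
    c = suc m C suc j
    distribute : ∀ m n x y p g → (m * x + y + p) * (n * g) ≡ m * (x * (n * g)) + n * (y * g) + n * (p * g)
    distribute = solve-∀
    collect : ∀ m n a b f → m * (b * f) + n * (b * f) + n * (a * f) ≡ (m * b + n * (a + b)) * f
    collect = solve-∀
    rearrange : ∀ m c f → m * c * f ≡ c * (m * f)
    rearrange = solve-∀

  openRow-closedForm zero    zero     = refl
  openRow-closedForm zero    (suc j)  = refl
  openRow-closedForm (suc m) zero     = begin
      suc (suc m) * (Y + 0) * 1        ≡⟨ distribute (suc (suc m)) Y ⟩
      suc (suc m) * (Y * 1)            ≡⟨ cong (suc (suc m) *_) (openRow-closedForm m 0) ⟩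
      suc (suc m) * (1 * F)            ≡⟨ rearrange (suc (suc m)) F ⟩
      1 * (suc (suc m) * F)            ∎
    where
    open ≡-Reasoning
    Y = openRow m 0
    F = suc m !
    distribute : ∀ n y → n * (y + 0) * 1 ≡ n * (y * 1)
    distribute = solve-∀
    rearrange : ∀ n f → n * (1 * f) ≡ 1 * (n * f)
    rearrange = solve-∀
  openRow-closedForm (suc m) (suc j) = begin
      suc (suc m) * (Y + P) * (suc j * G)
    ≡⟨ distribute (suc (suc m)) (suc j) Y P G ⟩
      suc (suc m) * (Y * (suc j * G) + P * (suc j * G))
    ≡⟨ cong₂ (λ x y → suc (suc m) * (x + y)) (openRow-closedForm m (suc j)) (closedRow-closedForm m j) ⟩
      suc (suc m) * (b * F + a * F)
    ≡⟨ collect (suc (suc m)) a b F ⟩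
      (a + b) * (suc (suc m) * F)
    ≡⟨ cong (_* (suc (suc m) * F)) (nCk+nC[k+1]≡[n+1]C[k+1] m j) ⟩
      c * (suc (suc m) * F) ∎
    where
    open ≡-Reasoning
    Y = openRow m (suc j)
    P = closedRow m j
    G = j !
    F = suc m !
    a = m C j
    b = m C suc j
    c = suc m C suc j
    distribute : ∀ n k y p g → n * (y + p) * (k * g) ≡ n * (y * (k * g) + p * (k * g))
    distribute = solve-∀
    collect : ∀ n a b f → n * (b * f + a * f) ≡ (a + b) * (n * f)
    collect = solve-∀

module RationalSums where
  open import Data.Nat as ℕ using (ℕ; zero; suc; NonZero; _!)
  open import Data.Nat.Properties as ℕ using (_!≢0)
  open import Data.Nat.Combinatorics using (_C_)
  open import Data.Integer as ℤ using (+_)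
  import Data.Integer.Properties as ℤ
  open import Data.Rational using (ℚ; _/_; _+_; _*_; 0ℚ)
  open import Data.Rational.Properties using (toℚᵘ-injective; toℚᵘ-fromℚᵘ; toℚᵘ-homo-+; toℚᵘ-homo-*; *-zeroʳ; *-distribˡ-+)
  open import Data.Rational.Unnormalised using (mkℚᵘ; *≡*)
  import Data.Rational.Unnormalised.Properties as ℚᵘ
  open import Data.List using ([]; _∷_; foldr; map; upTo; applyUpTo)
  open import Data.List.Properties using (map-cong)
  open import Relation.Binary.PropositionalEquality using (_≡_; refl; sym; trans; cong; cong₂; module ≡-Reasoning)
  open BoundedSums
  open Weights

  /1-homo-+ : ∀ a b → (+ a) / 1 + (+ b) / 1 ≡ (+ (a ℕ.+ b)) / 1
  /1-homo-+ a b = toℚᵘ-injective (ℚᵘ.≃-trans (toℚᵘ-homo-+ ((+ a) / 1) ((+ b) / 1))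
    (ℚᵘ.≃-trans (ℚᵘ.+-cong (toℚᵘ-fromℚᵘ (mkℚᵘ (+ a) 0)) (toℚᵘ-fromℚᵘ (mkℚᵘ (+ b) 0)))
    (ℚᵘ.≃-trans (*≡* cross) (ℚᵘ.≃-sym (toℚᵘ-fromℚᵘ (mkℚᵘ (+ (a ℕ.+ b)) 0))))))
    where
    cross : (+ a ℤ.* + 1 ℤ.+ + b ℤ.* + 1) ℤ.* + 1 ≡ + (a ℕ.+ b) ℤ.* + 1
    cross = trans (ℤ.*-identityʳ _) (trans (cong₂ ℤ._+_ (ℤ.*-identityʳ (+ a)) (ℤ.*-identityʳ (+ b)))
              (trans (sym (ℤ.pos-+ a b)) (sym (ℤ.*-identityʳ _))))

  /1-*-/ : ∀ a c d x .{{_ : NonZero d}} → x ℕ.* d ≡ a ℕ.* c → (+ a) / 1 * ((+ c) / d) ≡ (+ x) / 1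
  /1-*-/ a c (suc d) x xd≡ac = toℚᵘ-injective (ℚᵘ.≃-trans (toℚᵘ-homo-* ((+ a) / 1) ((+ c) / suc d))
    (ℚᵘ.≃-trans (ℚᵘ.*-cong (toℚᵘ-fromℚᵘ (mkℚᵘ (+ a) 0)) (toℚᵘ-fromℚᵘ (mkℚᵘ (+ c) d)))
    (ℚᵘ.≃-trans (*≡* cross) (ℚᵘ.≃-sym (toℚᵘ-fromℚᵘ (mkℚᵘ (+ x) 0))))))
    where
    cross : (+ a ℤ.* + c) ℤ.* + 1 ≡ + x ℤ.* + suc (d ℕ.+ 0)
    cross = trans (ℤ.*-identityʳ _) (trans (sym (ℤ.pos-* a c))
              (trans (cong +_ (sym (trans (cong (λ z → x ℕ.* suc z) (ℕ.+-identityʳ d)) xd≡ac))) (ℤ.pos-* x _)))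

  *-distribˡ-foldr : ∀ {A : Set} a (g : A → ℚ) xs →
                     a * foldr _+_ 0ℚ (map g xs) ≡ foldr _+_ 0ℚ (map (λ x → a * g x) xs)
  *-distribˡ-foldr a g []       = *-zeroʳ a
  *-distribˡ-foldr a g (x ∷ xs) = trans (*-distribˡ-+ a (g x) _) (cong (_+_ (a * g x)) (*-distribˡ-foldr a g xs))

  foldr-/1-applyUpTo : ∀ k (f h : ℕ → ℕ) →
                       foldr _+_ 0ℚ (map (λ i → (+ h i) / 1) (applyUpTo f k)) ≡ (+ ∑[ i < k ] h (f i)) / 1
  foldr-/1-applyUpTo zero    f h = refl
  foldr-/1-applyUpTo (suc k) f h =
    trans (cong (_+_ ((+ h (f 0)) / 1)) (foldr-/1-applyUpTo k (λ i → f (suc i)) h)) (/1-homo-+ (h (f 0)) _)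

  closedPrefix-Lah : ∀ m → (+ closedPrefix (suc m)) / 1
    ≡ ((+ (suc m !)) / 1) * foldr _+_ 0ℚ (map (λ i → _/_ (+ (m C i)) (suc i !) {{suc i !≢0}}) (upTo (suc m)))
  closedPrefix-Lah m = sym (begin
      F/1 * foldr _+_ 0ℚ (map term (upTo (suc m)))
    ≡⟨ *-distribˡ-foldr F/1 term (upTo (suc m)) ⟩
      foldr _+_ 0ℚ (map (λ i → F/1 * term i) (upTo (suc m)))
    ≡⟨ cong (foldr _+_ 0ℚ) (map-cong row (upTo (suc m))) ⟩
      foldr _+_ 0ℚ (map (λ i → (+ closedRow m i) / 1) (upTo (suc m)))
    ≡⟨ foldr-/1-applyUpTo (suc m) (λ i → i) (closedRow m) ⟩
      (+ ∑[ i < suc m ] closedRow m i) / 1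
    ≡⟨ cong (λ z → (+ z) / 1) (sym (closedPrefix-∑ m)) ⟩
      (+ closedPrefix (suc m)) / 1 ∎)
    where
    open ≡-Reasoning
    F/1 = (+ (suc m !)) / 1
    term : ℕ → ℚ
    term i = _/_ (+ (m C i)) (suc i !) {{suc i !≢0}}
    row : ∀ i → F/1 * term i ≡ (+ closedRow m i) / 1
    row i = /1-*-/ (suc m !) (m C i) (suc i !) (closedRow m i) {{suc i !≢0}}
              (trans (closedRow-closedForm m i) (ℕ.*-comm (m C i) (suc m !)))

module Booleans where
  open import Data.Nat using (_<_; _≤_; _<ᵇ_)
  open import Data.Nat.Properties using (<ᵇ⇒<; <⇒<ᵇ; <-≤-trans; <-irrefl)
  open import Data.Bool using (true; false; T)
  open import Data.Bool.Properties using (T-≡)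
  open import Function using (Equivalence)
  open import Relation.Nullary using (contradiction)
  open import Relation.Binary.PropositionalEquality using (_≡_; refl)

  ≡true⇒T : ∀ {b} → b ≡ true → T b
  ≡true⇒T = Equivalence.from T-≡

  T⇒≡true : ∀ {b} → T b → b ≡ true
  T⇒≡true = Equivalence.to T-≡

  T-ext : ∀ {a b} → (T a → T b) → (T b → T a) → a ≡ b
  T-ext {false} {false} _   _   = refl
  T-ext {false} {true}  _   b⇒a = contradiction _ b⇒a
  T-ext {true}  {false} a⇒b _   = contradiction _ a⇒b
  T-ext {true}  {true}  _   _   = refl

  <ᵇ-true : ∀ {m n} → m < n → (m <ᵇ n) ≡ true
  <ᵇ-true m<n = T⇒≡true (<⇒<ᵇ m<n)

  <ᵇ-false : ∀ {m n} → n ≤ m → (m <ᵇ n) ≡ false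
  <ᵇ-false {m} {n} n≤m with m <ᵇ n in eq
  ... | false = refl
  ... | true  = contradiction (<-≤-trans (<ᵇ⇒< m n (≡true⇒T eq)) n≤m) (<-irrefl refl)

module Patterns where
  open import Defs using (orderIso; contains; avoidsAll; subseqs)
  open import Data.Nat using (ℕ; suc; _<_; _≤_; _<ᵇ_)
  open import Data.Nat.Properties using (<-asym; <-cmp; <⇒≢; ≤-trans; <ᵇ⇒<; <⇒≤; <-irrefl; m≤n⇒m≤1+n)
  open import Data.Bool using (true; false; T; _∧_; not)
  open import Data.Bool.Properties using (T-∧; ∧-zeroʳ)
  open import Data.List using (List; []; _∷_; _++_; map; length)
  open import Data.List.Relation.Binary.Sublist.Propositional using (_⊆_; []; _∷_; _∷ʳ_; minimum)
  open import Data.List.Relation.Binary.Sublist.Heterogeneous.Properties using (length-mono-≤; ++⁺)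
  open import Data.List.Relation.Unary.All as All using (All)
  open import Data.List.Relation.Binary.Sublist.Propositional.Properties using (All-resp-⊆)
  open import Data.List.Relation.Unary.Any using (here)
  open import Data.List.Relation.Unary.Any.Properties using (any⁺; any⁻)
  open import Data.List.Membership.Propositional using (_∈_; find; lose)
  open import Data.List.Membership.Propositional.Properties using (∈-map⁺; ∈-map⁻; ∈-++⁺ˡ; ∈-++⁺ʳ; ∈-++⁻)
  open import Data.Product using (∃; ∃₂; _×_; _,_; proj₂)
  open import Data.Sum using (inj₁; inj₂)
  open import Data.Empty using (⊥-elim)
  open import Function using (Equivalence)
  open import Relation.Nullary using (¬_)
  open import Relation.Binary using (tri<; tri≈; tri>)
  open import Relation.Binary.PropositionalEquality using (_≡_; _≢_; refl; trans; cong; ≢-sym)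
  open Booleans

  σ312 σ321 : List ℕ
  σ312 = 3 ∷ 1 ∷ 2 ∷ []
  σ321 = 3 ∷ 2 ∷ 1 ∷ []

  forbidden : List (List ℕ)
  forbidden = σ312 ∷ σ321 ∷ []

  data BadTriple (π : List ℕ) : Set where
    badTriple : ∀ {a b c} → a ∷ b ∷ c ∷ [] ⊆ π → b < a → c < a → b ≢ c → BadTriple π

  ⊆-++-split : ∀ {A : Set} (xs : List A) {ys zs} → zs ⊆ xs ++ ys →
               ∃₂ λ zs₁ zs₂ → zs ≡ zs₁ ++ zs₂ × zs₁ ⊆ xs × zs₂ ⊆ ys
  ⊆-++-split []       p        = [] , _ , refl , [] , p
  ⊆-++-split (x ∷ xs) (x ∷ʳ p) with ⊆-++-split xs p
  ... | zs₁ , zs₂ , refl , p₁ , p₂ = zs₁ , zs₂ , refl , x ∷ʳ p₁ , p₂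
  ⊆-++-split (x ∷ xs) (refl ∷ p) with ⊆-++-split xs p
  ... | zs₁ , zs₂ , refl , p₁ , p₂ = x ∷ zs₁ , zs₂ , refl , refl ∷ p₁ , p₂

  -- c exceeds every entry before it, so in a bad triple it can only be the top, which
  -- needs two entries after it.
  BadTriple-dropMax : ∀ L c R → All (_< c) L → length R ≤ 1 → BadTriple (L ++ c ∷ R) → BadTriple (L ++ R)
  BadTriple-dropMax L c R L<c |R|≤1 (badTriple p b<a e<a b≢e) with ⊆-++-split L p
  ... | []             , _  , refl , _  , refl ∷ q = ⊥-elim (<-irrefl refl (≤-trans (length-mono-≤ q) |R|≤1))
  ... | []             , _  , refl , _  , _ ∷ʳ q   =
    ⊥-elim (<-irrefl refl (≤-trans (length-mono-≤ q) (m≤n⇒m≤1+n |R|≤1)))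
  ... | _ ∷ []         , _  , refl , p₁ , refl ∷ _ = ⊥-elim (<-asym b<a (All.head (All-resp-⊆ p₁ L<c)))
  ... | _ ∷ []         , _  , refl , p₁ , _ ∷ʳ q   = badTriple (++⁺ p₁ q) b<a e<a b≢e
  ... | _ ∷ _ ∷ []     , _  , refl , p₁ , refl ∷ _ = ⊥-elim (<-asym e<a (All.head (All-resp-⊆ p₁ L<c)))
  ... | _ ∷ _ ∷ []     , _  , refl , p₁ , _ ∷ʳ q   = badTriple (++⁺ p₁ q) b<a e<a b≢e
  ... | _ ∷ _ ∷ _ ∷ [] , [] , refl , p₁ , _        = badTriple (++⁺ p₁ (minimum R)) b<a e<a b≢e

  ∈-subseqs⁺ : ∀ {A : Set} {xs ys : List A} → xs ⊆ ys → xs ∈ subseqs ys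
  ∈-subseqs⁺ []                 = here refl
  ∈-subseqs⁺ (y ∷ʳ p)           = ∈-++⁺ʳ _ (∈-subseqs⁺ p)
  ∈-subseqs⁺ (_∷_ {x = x} refl p) = ∈-++⁺ˡ (∈-map⁺ (x ∷_) (∈-subseqs⁺ p))

  ∈-subseqs⁻ : ∀ {A : Set} {xs : List A} ys → xs ∈ subseqs ys → xs ⊆ ys
  ∈-subseqs⁻ []       (here refl) = []
  ∈-subseqs⁻ (y ∷ ys) p with ∈-++⁻ (map (y ∷_) (subseqs ys)) p
  ... | inj₁ q with ∈-map⁻ (y ∷_) q
  ...   | _ , q′ , refl = refl ∷ ∈-subseqs⁻ ys q′
  ∈-subseqs⁻ (y ∷ ys) p | inj₂ q = y ∷ʳ ∈-subseqs⁻ ys q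

  contains⁺ : ∀ {π s} σ → s ⊆ π → T (orderIso s σ) → T (contains π σ)
  contains⁺ σ s⊆π iso = any⁺ _ (lose (∈-subseqs⁺ s⊆π) iso)

  contains⁻ : ∀ π σ → T (contains π σ) → ∃ λ s → s ⊆ π × T (orderIso s σ)
  contains⁻ π σ t with find (any⁻ _ (subseqs π) t)
  ... | s , s∈ , iso = s , ∈-subseqs⁻ π s∈ , iso

  orderIso-length : ∀ s t → T (orderIso s t) → length s ≡ length t
  orderIso-length []      []      _   = refl
  orderIso-length (x ∷ s) (y ∷ t) iso = cong suc (orderIso-length s t (proj₂ (Equivalence.to T-∧ iso)))

  contains-triple⁻ : ∀ π {x y z} → T (contains π (x ∷ y ∷ z ∷ [])) →
                     ∃₂ λ a b → ∃ λ c → a ∷ b ∷ c ∷ [] ⊆ π × T (orderIso (a ∷ b ∷ c ∷ []) (x ∷ y ∷ z ∷ []))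
  contains-triple⁻ π t with contains⁻ π _ t
  ... | s , s⊆π , iso = shape s s⊆π iso (orderIso-length s _ iso)
    where
    shape : ∀ s → s ⊆ π → T (orderIso s _) → length s ≡ 3 → _
    shape (a ∷ b ∷ c ∷ []) s⊆π iso refl = a , b , c , s⊆π , iso

  orderIso-312⁺ : ∀ {a b c} → b < a → c < a → b < c → T (orderIso (a ∷ b ∷ c ∷ []) σ312)
  orderIso-312⁺ b<a c<a b<c
    rewrite <ᵇ-false (<⇒≤ b<a) | <ᵇ-true b<a | <ᵇ-false (<⇒≤ c<a) | <ᵇ-true c<a
          | <ᵇ-true b<c | <ᵇ-false (<⇒≤ b<c) = _

  orderIso-321⁺ : ∀ {a b c} → b < a → c < a → c < b → T (orderIso (a ∷ b ∷ c ∷ []) σ321)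
  orderIso-321⁺ b<a c<a c<b
    rewrite <ᵇ-false (<⇒≤ b<a) | <ᵇ-true b<a | <ᵇ-false (<⇒≤ c<a) | <ᵇ-true c<a
          | <ᵇ-true c<b | <ᵇ-false (<⇒≤ c<b) = _

  orderIso-312⁻ : ∀ a b c → T (orderIso (a ∷ b ∷ c ∷ []) σ312) → b < a × c < a × b ≢ c
  orderIso-312⁻ a b c iso with a <ᵇ b | b <ᵇ a in b<a | a <ᵇ c | c <ᵇ a in c<a | b <ᵇ c in b<c | c <ᵇ b
  ... | false | true | false | true | true | false =
    <ᵇ⇒< b a (≡true⇒T b<a) , <ᵇ⇒< c a (≡true⇒T c<a) , <⇒≢ (<ᵇ⇒< b c (≡true⇒T b<c))

  orderIso-321⁻ : ∀ a b c → T (orderIso (a ∷ b ∷ c ∷ []) σ321) → b < a × c < a × b ≢ c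
  orderIso-321⁻ a b c iso with a <ᵇ b | b <ᵇ a in b<a | a <ᵇ c | c <ᵇ a in c<a | b <ᵇ c | c <ᵇ b in c<b
  ... | false | true | false | true | false | true =
    <ᵇ⇒< b a (≡true⇒T b<a) , <ᵇ⇒< c a (≡true⇒T c<a) , ≢-sym (<⇒≢ (<ᵇ⇒< c b (≡true⇒T c<b)))

  avoidsAll-bad : ∀ π → BadTriple π → avoidsAll π forbidden ≡ false
  avoidsAll-bad π (badTriple {b = b} {c} p b<a c<a b≢c) with <-cmp b c
  ... | tri< b<c _ _ =
    cong (λ x → not x ∧ not (contains π σ321) ∧ true) (T⇒≡true (contains⁺ σ312 p (orderIso-312⁺ b<a c<a b<c)))
  ... | tri≈ _ b≡c _ = ⊥-elim (b≢c b≡c)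
  ... | tri> _ _ c<b = trans
    (cong (λ x → not (contains π σ312) ∧ not x ∧ true)
          (T⇒≡true (contains⁺ σ321 p (orderIso-321⁺ b<a c<a c<b))))
    (∧-zeroʳ _)

  avoidsAll-false : ∀ π → avoidsAll π forbidden ≡ false → BadTriple π
  avoidsAll-false π _ with contains π σ312 in c₁ | contains π σ321 in c₂
  ... | true | _ with contains-triple⁻ π (≡true⇒T c₁)
  ...   | a , b , c , p , iso with orderIso-312⁻ a b c iso
  ...     | b<a , c<a , b≢c = badTriple p b<a c<a b≢c
  avoidsAll-false π _ | false | true with contains-triple⁻ π (≡true⇒T c₂)
  ...   | a , b , c , p , iso with orderIso-321⁻ a b c iso
  ...     | b<a , c<a , b≢c = badTriple p b<a c<a b≢c

  avoidsAll-good : ∀ π → ¬ BadTriple π → avoidsAll π forbidden ≡ true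
  avoidsAll-good π good with avoidsAll π forbidden in e
  ... | true  = refl
  ... | false = ⊥-elim (good (avoidsAll-false π e))

module ParkingProcess where
  open import Defs using (val; placeFrom; park; emptySpots; parkingOutcome)
  open import Data.Nat using (ℕ; zero; suc; _+_)
  open import Data.Nat.Properties using (+-identityʳ; +-suc; suc-injective)
  open import Data.Fin using (Fin; toℕ)
  open import Data.Bool using (Bool)
  open import Data.Bool.ListAction using (all)
  open import Data.Maybe using (Maybe; just; nothing; is-just)
  open import Data.List using (List; []; _∷_; length; map; foldl; zip; applyUpTo)
  open import Data.Vec using (Vec; toList)
  open import Data.Vec.Properties using (length-toList)
  open import Data.Product using (proj₁; proj₂)
  open import Relation.Binary.PropositionalEquality using (_≡_; refl; trans; cong)

  Spots : Set
  Spots = List (Maybe ℕ)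

  full : Spots → Bool
  full = all is-just

  runFrom : ∀ {n} → Spots → ℕ → List (Fin n) → Spots
  runFrom st c []       = st
  runFrom st c (x ∷ xs) = runFrom (placeFrom c (toℕ x) st) (suc c) xs

  foldl-park≡runFrom : ∀ {n} (g : ℕ → ℕ) c (xs : List (Fin n)) st k →
    length xs ≡ k → (∀ i → g i ≡ c + i) →
    foldl (λ st cp → park (proj₁ cp) (proj₂ cp) st) st (zip (applyUpTo g k) (map val xs)) ≡ runFrom st c xs
  foldl-park≡runFrom g c []       st zero    _   _    = refl
  foldl-park≡runFrom g c (x ∷ xs) st (suc k) len g≗c+ =
    trans (cong (λ d → foldl (λ st cp → park (proj₁ cp) (proj₂ cp) st) (placeFrom d (toℕ x) st)
                             (zip (applyUpTo (λ i → g (suc i)) k) (map val xs)))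
                (trans (g≗c+ 0) (+-identityʳ c)))
          (foldl-park≡runFrom (λ i → g (suc i)) (suc c) xs _ k (suc-injective len)
                              (λ i → trans (g≗c+ (suc i)) (+-suc c i)))

  parkingOutcome≡runFrom : ∀ {n} (f : Vec (Fin n) n) → parkingOutcome f ≡ runFrom (emptySpots n) 1 (toList f)
  parkingOutcome≡runFrom {n} f = foldl-park≡runFrom suc 1 (toList f) (emptySpots n) n (length-toList f) (λ _ → refl)

  length-placeFrom : ∀ c s st → length (placeFrom c s st) ≡ length st
  length-placeFrom c s       []              = refl
  length-placeFrom c (suc s) (x ∷ st)        = cong suc (length-placeFrom c s st)
  length-placeFrom c zero    (nothing ∷ st)  = refl
  length-placeFrom c zero    (just x ∷ st)   = cong suc (length-placeFrom c zero st)

  length-runFrom : ∀ {n} (xs : List (Fin n)) st c → length (runFrom st c xs) ≡ length st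
  length-runFrom []       st c = refl
  length-runFrom (x ∷ xs) st c = trans (length-runFrom xs _ (suc c)) (length-placeFrom c (toℕ x) st)

  length-emptySpots : ∀ n → length (emptySpots n) ≡ n
  length-emptySpots zero    = refl
  length-emptySpots (suc n) = cong suc (length-emptySpots n)

module ParkingCriterion where
  open import Defs using (val; placeFrom; emptySpots; isParking)
  open import Data.Nat using (ℕ; zero; suc; _+_; _≤_; _<_; _≤?_; _<ᵇ_; z≤n; s≤s; z<s; s<s)
  open import Data.Nat.Properties
    using (≤-refl; ≤-trans; ≤-reflexive; <-irrefl; <-cmp; n≤1+n; m≤n⇒m≤1+n; ≰⇒>; +-comm; +-assoc; +-identityʳ; suc-injective)
  open import Data.Fin using (Fin; toℕ)
  open import Data.Bool using (Bool; true; false; T)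
  open import Data.Bool.Properties using (T?)
  open import Data.Maybe using (just; nothing)
  open import Data.List using (List; []; _∷_; length; filter)
  open import Data.List.Relation.Unary.All.Properties using (all⁺; all⁻; applyUpTo⁺₁; applyUpTo⁻)
  open import Data.Vec using (Vec; toList)
  open import Data.Product using (∃; _×_; _,_; map₂)
  open import Function using (_∘_)
  open import Relation.Nullary using (¬_; yes; no; contradiction)
  open import Relation.Nullary.Decidable using (fromWitness; toWitness)
  open import Data.Bool.ListAction using (all)
  open import Relation.Binary using (tri<; tri≈; tri>)
  open import Relation.Binary.PropositionalEquality using (_≡_; _≢_; refl; sym; trans; subst; cong)
  open ParkingProcess
  open Booleans using (T-ext; <ᵇ-true; <ᵇ-false)

  emptyAt : ℕ → Spots → Bool
  emptyAt zero    []            = false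
  emptyAt zero    (nothing ∷ _) = true
  emptyAt zero    (just _ ∷ _)  = false
  emptyAt (suc t) []            = false
  emptyAt (suc t) (_ ∷ st)      = emptyAt t st

  occupiedBelow : ℕ → Spots → ℕ
  occupiedBelow zero    _              = 0
  occupiedBelow (suc i) []             = 0
  occupiedBelow (suc i) (nothing ∷ st) = occupiedBelow i st
  occupiedBelow (suc i) (just _ ∷ st)  = suc (occupiedBelow i st)

  data Placement (c s : ℕ) (st : Spots) : Set where
    unplaced : placeFrom c s st ≡ st → (∀ t → s ≤ t → emptyAt t st ≡ false) → Placement c s st
    placedAt : ∀ q → s ≤ q → (∀ t → s ≤ t → t < q → emptyAt t st ≡ false) →
               (∀ i → i ≤ q → occupiedBelow i (placeFrom c s st) ≡ occupiedBelow i st) →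
               (∀ i → q < i → occupiedBelow i (placeFrom c s st) ≡ suc (occupiedBelow i st)) →
               (∀ t → emptyAt t (placeFrom c s st) ≡ true → emptyAt t st ≡ true × t ≢ q) →
               Placement c s st

  placement : ∀ c s st → Placement c s st
  placement c s       []             = unplaced refl (λ { zero _ → refl ; (suc t) _ → refl })
  placement c (suc s) (x ∷ st)       with placement c s st
  ... | unplaced same none =
    unplaced (cong (x ∷_) same) λ { zero () ; (suc t) (s≤s s≤t) → none t s≤t }
  ... | placedAt q s≤q skipped below above holes =
    placedAt (suc q) (s≤s s≤q)
      (λ { zero () _ ; (suc t) (s≤s s≤t) (s<s t<q) → skipped t s≤t t<q })
      (λ { zero _ → refl ; (suc i) (s≤s i≤q) → occupiedBelow-∷ x (below i i≤q) })
      (λ { zero () ; (suc i) (s<s q<i) → occupiedBelow-∷-suc x (above i q<i) })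
      (λ { zero e → emptyAt-0 x e , (λ ()) ; (suc t) e → map₂ (_∘ suc-injective) (holes t e) })
    where
    occupiedBelow-∷ : ∀ {i xs ys} x → occupiedBelow i xs ≡ occupiedBelow i ys →
                      occupiedBelow (suc i) (x ∷ xs) ≡ occupiedBelow (suc i) (x ∷ ys)
    occupiedBelow-∷ nothing  e = e
    occupiedBelow-∷ (just _) e = cong suc e
    occupiedBelow-∷-suc : ∀ {i xs ys} x → occupiedBelow i xs ≡ suc (occupiedBelow i ys) →
                          occupiedBelow (suc i) (x ∷ xs) ≡ suc (occupiedBelow (suc i) (x ∷ ys))
    occupiedBelow-∷-suc nothing  e = e
    occupiedBelow-∷-suc (just _) e = cong suc e
    emptyAt-0 : ∀ {xs} x → emptyAt 0 (x ∷ xs) ≡ true → emptyAt 0 (x ∷ st) ≡ true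
    emptyAt-0 nothing e = refl
  placement c zero    (nothing ∷ st) =
    placedAt 0 z≤n (λ _ _ ()) (λ { zero _ → refl ; (suc i) () }) (λ { zero () ; (suc i) _ → refl })
      (λ { zero () ; (suc t) e → e , (λ ()) })
  placement c zero    (just y ∷ st)  with placement c zero st
  ... | unplaced same none =
    unplaced (cong (just y ∷_) same) λ { zero _ → refl ; (suc t) _ → none t z≤n }
  ... | placedAt q _ skipped below above holes =
    placedAt (suc q) z≤n
      (λ { zero _ _ → refl ; (suc t) _ (s<s t<q) → skipped t z≤n t<q })
      (λ { zero _ → refl ; (suc i) (s≤s i≤q) → cong suc (below i i≤q) })
      (λ { zero () ; (suc i) (s<s q<i) → cong suc (above i q<i) })
      (λ { zero () ; (suc t) e → map₂ (_∘ suc-injective) (holes t e) })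

  -- κ t is the number of cars preferring one of the spots 0, …, t. Cars only move right, so
  -- at most κ t cars sit in these spots; if spot t is still empty, all of them parked before it.
  record Consistent (st : Spots) (κ : ℕ → ℕ) : Set where
    constructor consistent
    field
      occupied≤ : ∀ t → occupiedBelow (suc t) st ≤ κ t
      ≤occupied : ∀ t → emptyAt t st ≡ true → κ t ≤ occupiedBelow t st

  Consistent-placeFrom : ∀ c s st (κ κ′ : ℕ → ℕ) → Consistent st κ →
    (∀ t → s ≤ t → κ′ t ≡ suc (κ t)) → (∀ t → t < s → κ′ t ≡ κ t) →
    Consistent (placeFrom c s st) κ′
  Consistent-placeFrom c s st κ κ′ (consistent occ≤ ≤occ) up same = after (placement c s st)
    where
    κ≤κ′ : ∀ t → κ t ≤ κ′ t
    κ≤κ′ t with s ≤? t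
    ... | yes s≤t = ≤-trans (n≤1+n _) (≤-reflexive (sym (up t s≤t)))
    ... | no  s≰t = ≤-reflexive (sym (same t (≰⇒> s≰t)))

    after : Placement c s st → Consistent (placeFrom c s st) κ′
    after (unplaced unchanged none) rewrite unchanged = consistent (λ t → ≤-trans (occ≤ t) (κ≤κ′ t)) ≤occ′
      where
      ≤occ′ : ∀ t → emptyAt t st ≡ true → κ′ t ≤ occupiedBelow t st
      ≤occ′ t empty with s ≤? t
      ... | yes s≤t = contradiction (trans (sym empty) (none t s≤t)) λ ()
      ... | no  s≰t = subst (_≤ occupiedBelow t st) (sym (same t (≰⇒> s≰t))) (≤occ t empty)
    after (placedAt q s≤q skipped below above holes) = consistent occ≤′ ≤occ′
      where
      st′ = placeFrom c s st
      occupiedBelow-mono : ∀ t → occupiedBelow t st ≤ occupiedBelow t st′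
      occupiedBelow-mono t with t ≤? q
      ... | yes t≤q = ≤-reflexive (sym (below t t≤q))
      ... | no  t≰q = ≤-trans (n≤1+n _) (≤-reflexive (sym (above t (≰⇒> t≰q))))
      occ≤′ : ∀ t → occupiedBelow (suc t) st′ ≤ κ′ t
      occ≤′ t with q ≤? t
      ... | yes q≤t = ≤-trans (≤-reflexive (above (suc t) (s≤s q≤t)))
                              (≤-trans (s≤s (occ≤ t)) (≤-reflexive (sym (up t (≤-trans s≤q q≤t)))))
      ... | no  q≰t = ≤-trans (≤-reflexive (below (suc t) (≰⇒> q≰t))) (≤-trans (occ≤ t) (κ≤κ′ t))
      ≤occ′ : ∀ t → emptyAt t st′ ≡ true → κ′ t ≤ occupiedBelow t st′
      ≤occ′ t empty′ with holes t empty′ | s ≤? t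
      ... | empty , t≢q | yes s≤t =
        ≤-trans (≤-reflexive (up t s≤t)) (≤-trans (s≤s (≤occ t empty)) (≤-reflexive (sym (above t q<t))))
        where
        q<t : q < t
        q<t with <-cmp q t
        ... | tri< q<t _ _ = q<t
        ... | tri≈ _ q≡t _ = contradiction (sym q≡t) t≢q
        ... | tri> _ _ t<q = contradiction (trans (sym empty) (skipped t s≤t t<q)) λ ()
      ... | empty , _ | no s≰t =
        ≤-trans (≤-reflexive (same t (≰⇒> s≰t))) (≤-trans (≤occ t empty) (occupiedBelow-mono t))

  Consistent-cong : ∀ {st κ κ′} → (∀ t → κ t ≡ κ′ t) → Consistent st κ → Consistent st κ′
  Consistent-cong {st} κ≗κ′ (consistent occ≤ ≤occ) =
    consistent (λ t → subst (occupiedBelow (suc t) st ≤_) (κ≗κ′ t) (occ≤ t))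
               (λ t empty → subst (_≤ occupiedBelow t st) (κ≗κ′ t) (≤occ t empty))

  preferringAtMost : ∀ {n} → ℕ → List (Fin n) → ℕ
  preferringAtMost t xs = length (filter (λ v → val v ≤? suc t) xs)

  preferringAtMost-∷ : ∀ {n} t (x : Fin n) xs →
                       preferringAtMost t (x ∷ xs) ≡ preferringAtMost t (x ∷ []) + preferringAtMost t xs
  preferringAtMost-∷ t x xs with toℕ x <ᵇ suc t
  ... | true  = refl
  ... | false = refl

  preferringAtMost-≤ : ∀ {n} t (x : Fin n) → toℕ x ≤ t → preferringAtMost t (x ∷ []) ≡ 1
  preferringAtMost-≤ t x x≤t rewrite <ᵇ-true {toℕ x} {suc t} (s≤s x≤t) = refl

  preferringAtMost-> : ∀ {n} t (x : Fin n) → t < toℕ x → preferringAtMost t (x ∷ []) ≡ 0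
  preferringAtMost-> t x t<x rewrite <ᵇ-false {toℕ x} {suc t} t<x = refl

  Consistent-runFrom : ∀ {n} (xs : List (Fin n)) st c κ → Consistent st κ →
                       Consistent (runFrom st c xs) (λ t → κ t + preferringAtMost t xs)
  Consistent-runFrom []       st c κ inv = Consistent-cong (λ t → sym (+-identityʳ (κ t))) inv
  Consistent-runFrom (x ∷ xs) st c κ inv =
    Consistent-cong (λ t → trans (+-assoc (κ t) _ _) (cong (κ t +_) (sym (preferringAtMost-∷ t x xs))))
      (Consistent-runFrom xs _ (suc c) _
        (Consistent-placeFrom c (toℕ x) st κ (λ t → κ t + preferringAtMost t (x ∷ [])) inv
          (λ t x≤t → trans (cong (κ t +_) (preferringAtMost-≤ t x x≤t)) (+-comm (κ t) 1))
          (λ t t<x → trans (cong (κ t +_) (preferringAtMost-> t x t<x)) (+-identityʳ (κ t)))))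

  Consistent-emptySpots : ∀ n → Consistent (emptySpots n) (λ _ → 0)
  Consistent-emptySpots n = consistent (λ t → ≤-reflexive (empty n (suc t))) (λ _ _ → z≤n)
    where
    empty : ∀ n i → occupiedBelow i (emptySpots n) ≡ 0
    empty n       zero    = refl
    empty zero    (suc i) = refl
    empty (suc n) (suc i) = empty n i

  occupiedBelow-full : ∀ st t → T (full st) → t < length st → occupiedBelow (suc t) st ≡ suc t
  occupiedBelow-full (just _ ∷ st) zero    _    _         = refl
  occupiedBelow-full (just _ ∷ st) (suc t) full (s<s t<l) = cong suc (occupiedBelow-full st t full t<l)

  occupiedBelow-≤ : ∀ t st → occupiedBelow t st ≤ t
  occupiedBelow-≤ zero    st             = z≤n
  occupiedBelow-≤ (suc t) []             = z≤n
  occupiedBelow-≤ (suc t) (nothing ∷ st) = m≤n⇒m≤1+n (occupiedBelow-≤ t st)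
  occupiedBelow-≤ (suc t) (just _ ∷ st)  = s≤s (occupiedBelow-≤ t st)

  emptyAt-¬full : ∀ st → ¬ T (full st) → ∃ λ t → t < length st × emptyAt t st ≡ true
  emptyAt-¬full []            notFull = contradiction _ notFull
  emptyAt-¬full (nothing ∷ st) _      = 0 , z<s , refl
  emptyAt-¬full (just _ ∷ st) notFull with emptyAt-¬full st notFull
  ... | t , t<l , empty = suc t , s<s t<l , empty

  isParking≡full : ∀ {n} (f : Vec (Fin n) n) → isParking f ≡ full (runFrom (emptySpots n) 1 (toList f))
  isParking≡full {n} f = T-ext parking⇒full full⇒parking
    where
    st = runFrom (emptySpots n) 1 (toList f)
    length-st : length st ≡ n
    length-st = trans (length-runFrom (toList f) (emptySpots n) 1) (length-emptySpots n)
    inv : Consistent st (λ t → 0 + preferringAtMost t (toList f))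
    inv = Consistent-runFrom (toList f) (emptySpots n) 1 (λ _ → 0) (Consistent-emptySpots n)

    full⇒parking : T (full st) → T (isParking f)
    full⇒parking isFull = all⁻ _ (applyUpTo⁺₁ suc n (λ {t} t<n → fromWitness (enough t t<n)))
      where
      enough : ∀ t → t < n → suc t ≤ preferringAtMost t (toList f)
      enough t t<n = ≤-trans (≤-reflexive (sym (occupiedBelow-full st t isFull (subst (t <_) (sym length-st) t<n))))
                             (Consistent.occupied≤ inv t)

    parking⇒full : T (isParking f) → T (full st)
    parking⇒full isP with T? (full st)
    ... | yes isFull = isFull
    ... | no  notFull with emptyAt-¬full st notFull
    ...   | t , t<l , empty =
      contradiction (toWitness (applyUpTo⁻ suc n (all⁺ _ _ isP) (subst (t <_) length-st t<l))) too-few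
      where
      too-few : ¬ suc t ≤ preferringAtMost t (toList f)
      too-few t<K = <-irrefl refl (≤-trans t<K (≤-trans (Consistent.≤occupied inv t empty) (occupiedBelow-≤ t st)))

module Transfer where
  open import Defs using (placeFrom; emptySpots; avoidsAll)
  open import Data.Nat using (ℕ; zero; suc; _+_; _*_; _∸_; _≤_; _<_; z≤n; s≤s; z<s)
  open import Data.Nat.Properties using (≤-refl; ≤-trans; ≤-pred; n<1+n; m<n⇒m<1+n; <⇒≢; +-comm; +-suc; +-identityʳ; m+[n∸m]≡n; m∸n≤m)
  open import Data.Nat.Induction using (<-rec)
  open import Data.Bool using (Bool; true; false; _∧_)
  open import Data.Bool.Properties using (∧-zeroʳ)
  open import Data.Maybe using (just; nothing)
  open import Data.List using (List; []; _∷_; _++_; map; length; replicate; catMaybes)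
  open import Data.List.Properties using (catMaybes-++; map-++; ++-assoc; ++-identityʳ; length-++)
  open import Data.List.Relation.Unary.All as All using (All; []; _∷_)
  open import Data.List.Relation.Unary.All.Properties using () renaming (++⁺ to All-++⁺)
  open import Data.List.Relation.Binary.Sublist.Propositional using (_⊆_; []; _∷_; _∷ʳ_; ⊆-refl; ⊆-trans; minimum)
  open import Data.List.Relation.Binary.Sublist.Heterogeneous.Properties using (++⁺)
  open import Data.Product using (∃₂; _×_; _,_)
  open import Data.Sum using (_⊎_; inj₁; inj₂)
  open import Relation.Nullary using (¬_)
  open import Relation.Binary.PropositionalEquality using (_≡_; _≢_; refl; sym; trans; subst; cong; ≢-sym; module ≡-Reasoning)
  open BoundedSums
  open Weights using (closedPrefix; closedSuffix; gappedSuffix; ∑-gappedSuffix; closedSuffix-from-0)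
  open Patterns using (forbidden; BadTriple; badTriple; BadTriple-dropMax; avoidsAll-bad; avoidsAll-good; ⊆-++-split)
  open ParkingProcess

  good : Spots → Bool
  good st = full st ∧ avoidsAll (catMaybes st) forbidden

  indicator : Bool → ℕ
  indicator true  = 1
  indicator false = 0

  goodRuns : ℕ → Spots → ℕ → ℕ → ℕ
  goodRuns n st c zero    = indicator (good st)
  goodRuns n st c (suc k) = ∑[ s < n ] goodRuns n (placeFrom c s st) (suc c) k

  holes : Spots → ℕ
  holes []             = 0
  holes (nothing ∷ st) = suc (holes st)
  holes (just _ ∷ st)  = holes st

  holes-placeFrom : ∀ c s st → holes st ≤ suc (holes (placeFrom c s st))
  holes-placeFrom c s       []             = z≤n
  holes-placeFrom c (suc s) (nothing ∷ st) = s≤s (holes-placeFrom c s st)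
  holes-placeFrom c (suc s) (just _ ∷ st)  = holes-placeFrom c s st
  holes-placeFrom c zero    (nothing ∷ st) = ≤-refl
  holes-placeFrom c zero    (just _ ∷ st)  = holes-placeFrom c zero st

  full-holes : ∀ st → 0 < holes st → full st ≡ false
  full-holes (nothing ∷ st) _   = refl
  full-holes (just _ ∷ st)  0<h = full-holes st 0<h

  goodRuns-fewCars : ∀ n k st c → k < holes st → goodRuns n st c k ≡ 0
  goodRuns-fewCars n zero    st c k<h rewrite full-holes st k<h = refl
  goodRuns-fewCars n (suc k) st c k<h =
    ∑-zero n (λ s _ → goodRuns-fewCars n k (placeFrom c s st) (suc c) (≤-pred (≤-trans k<h (holes-placeFrom c s st))))

  catMaybes-placeFrom : ∀ c s st → catMaybes st ⊆ catMaybes (placeFrom c s st)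
  catMaybes-placeFrom c s       []             = []
  catMaybes-placeFrom c (suc s) (nothing ∷ st) = catMaybes-placeFrom c s st
  catMaybes-placeFrom c (suc s) (just x ∷ st)  = refl ∷ catMaybes-placeFrom c s st
  catMaybes-placeFrom c zero    (nothing ∷ st) = c ∷ʳ ⊆-refl
  catMaybes-placeFrom c zero    (just x ∷ st)  = refl ∷ catMaybes-placeFrom c zero st

  goodRuns-bad : ∀ n k st c → BadTriple (catMaybes st) → goodRuns n st c k ≡ 0
  goodRuns-bad n zero    st c bad rewrite avoidsAll-bad _ bad = cong indicator (∧-zeroʳ (full st))
  goodRuns-bad n (suc k) st c (badTriple p b<a c<a b≢c) =
    ∑-zero n (λ s _ → goodRuns-bad n k (placeFrom c s st) (suc c)
                        (badTriple (⊆-trans p (catMaybes-placeFrom c s st)) b<a c<a b≢c))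

  ⊆-catMaybes-∷ : ∀ {xs} x (ys : Spots) → xs ⊆ catMaybes ys → xs ⊆ catMaybes (x ∷ ys)
  ⊆-catMaybes-∷ nothing  ys p = p
  ⊆-catMaybes-∷ (just y) ys p = y ∷ʳ p

  placeFrom-hole : ∀ c s A B →
    (∃₂ λ A′ B′ → placeFrom c s (A ++ nothing ∷ B) ≡ A′ ++ nothing ∷ B′ × catMaybes B ⊆ catMaybes B′)
    ⊎ (c ∷ catMaybes B ⊆ catMaybes (placeFrom c s (A ++ nothing ∷ B)))
  placeFrom-hole c zero    []             B = inj₂ ⊆-refl
  placeFrom-hole c (suc s) []             B = inj₁ ([] , placeFrom c s B , refl , catMaybes-placeFrom c s B)
  placeFrom-hole c (suc s) (x ∷ A)        B with placeFrom-hole c s A B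
  ... | inj₁ (A′ , B′ , eq , p) = inj₁ (x ∷ A′ , B′ , cong (x ∷_) eq , p)
  ... | inj₂ p                  = inj₂ (⊆-catMaybes-∷ x (placeFrom c s (A ++ nothing ∷ B)) p)
  placeFrom-hole c zero    (nothing ∷ A)  B = inj₁ (just c ∷ A , B , refl , ⊆-refl)
  placeFrom-hole c zero    (just y ∷ A)   B with placeFrom-hole c zero A B
  ... | inj₁ (A′ , B′ , eq , p) = inj₁ (just y ∷ A′ , B′ , cong (just y ∷_) eq , p)
  ... | inj₂ p                  = inj₂ (y ∷ʳ p)

  holes-++-hole : ∀ A B → 0 < holes (A ++ nothing ∷ B)
  holes-++-hole []            B = z<s
  holes-++-hole (nothing ∷ A) B = z<s
  holes-++-hole (just _ ∷ A)  B = holes-++-hole A B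

  -- Whichever car finally fills the hole is larger than x and y, which follow it.
  goodRuns-holeBeforePair : ∀ n k A B c {x y} → x ∷ y ∷ [] ⊆ catMaybes B → x < c → y < c → x ≢ y →
                            goodRuns n (A ++ nothing ∷ B) c k ≡ 0
  goodRuns-holeBeforePair n zero    A B c _ _ _ _ rewrite full-holes (A ++ nothing ∷ B) (holes-++-hole A B) = refl
  goodRuns-holeBeforePair n (suc k) A B c xy⊆B x<c y<c x≢y = ∑-zero n afterPlacing
    where
    afterPlacing : ∀ s → s < n → goodRuns n (placeFrom c s (A ++ nothing ∷ B)) (suc c) k ≡ 0
    afterPlacing s _ with placeFrom-hole c s A B
    ... | inj₁ (A′ , B′ , eq , B⊆B′) rewrite eq =
      goodRuns-holeBeforePair n k A′ B′ (suc c) (⊆-trans xy⊆B B⊆B′) (m<n⇒m<1+n x<c) (m<n⇒m<1+n y<c) x≢y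
    ... | inj₂ cB⊆ = goodRuns-bad n k (placeFrom c s (A ++ nothing ∷ B)) (suc c)
                       (badTriple (⊆-trans (refl ∷ xy⊆B) cB⊆) x<c y<c x≢y)

  placeFrom-cases : ∀ c s R →
    placeFrom c s R ≡ R ⊎ ∃₂ λ A B → R ≡ A ++ nothing ∷ B × placeFrom c s R ≡ A ++ just c ∷ B
  placeFrom-cases c s       []            = inj₁ refl
  placeFrom-cases c (suc s) (x ∷ R)       with placeFrom-cases c s R
  ... | inj₁ same                  = inj₁ (cong (x ∷_) same)
  ... | inj₂ (A , B , refl , eq)   = inj₂ (x ∷ A , B , refl , cong (x ∷_) eq)
  placeFrom-cases c zero    (nothing ∷ R) = inj₂ ([] , R , refl , refl)
  placeFrom-cases c zero    (just y ∷ R)  with placeFrom-cases c zero R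
  ... | inj₁ same                  = inj₁ (cong (just y ∷_) same)
  ... | inj₂ (A , B , refl , eq)   = inj₂ (just y ∷ A , B , refl , cong (just y ∷_) eq)

  placeFrom-beside : ∀ c s R d → d ∷ [] ⊆ catMaybes R →
    placeFrom c s R ≡ R ⊎ (c ∷ d ∷ [] ⊆ catMaybes (placeFrom c s R)
                         ⊎ d ∷ c ∷ [] ⊆ catMaybes (placeFrom c s R))
  placeFrom-beside c s R d d∈R with placeFrom-cases c s R
  ... | inj₁ same = inj₁ same
  ... | inj₂ (A , B , refl , placed)
    rewrite placed | catMaybes-++ A (just c ∷ B) | catMaybes-++ A (nothing ∷ B)
    with ⊆-++-split (catMaybes A) d∈R
  ...   | [] , _ , refl , _ , d∈B           = inj₂ (inj₁ (++⁺ (minimum (catMaybes A)) (refl ∷ d∈B)))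
  ...   | _ ∷ [] , [] , refl , d∈A , _      = inj₂ (inj₂ (++⁺ d∈A (refl ∷ minimum (catMaybes B))))

  placeFrom-filled : ∀ c s L R → s ≤ length L →
                     placeFrom c s (map just L ++ nothing ∷ R) ≡ map just L ++ just c ∷ R
  placeFrom-filled c zero    []      R _         = refl
  placeFrom-filled c zero    (x ∷ L) R _         = cong (just x ∷_) (placeFrom-filled c zero L R z≤n)
  placeFrom-filled c (suc s) (x ∷ L) R (s≤s s≤l) = cong (just x ∷_) (placeFrom-filled c s L R s≤l)

  placeFrom-beyond : ∀ c j L R →
    placeFrom c (suc (length L + j)) (map just L ++ nothing ∷ R) ≡ map just L ++ nothing ∷ placeFrom c j R
  placeFrom-beyond c j []      R = refl
  placeFrom-beyond c j (x ∷ L) R = cong (just x ∷_) (placeFrom-beyond c j L R)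

  placeFrom-replicate : ∀ c j m → j < m →
    placeFrom c j (replicate m nothing) ≡ replicate j nothing ++ just c ∷ replicate (m ∸ suc j) nothing
  placeFrom-replicate c zero    (suc m) _         = refl
  placeFrom-replicate c (suc j) (suc m) (s≤s j<m) = cong (nothing ∷_) (placeFrom-replicate c j m j<m)

  map-just-++ : ∀ (L M : List ℕ) X → map just (L ++ M) ++ X ≡ map just L ++ (map just M ++ X)
  map-just-++ L M X = trans (cong (_++ X) (map-++ just L M)) (++-assoc (map just L) (map just M) X)

  catMaybes-map-just : ∀ (L : List ℕ) → catMaybes (map just L) ≡ L
  catMaybes-map-just []      = refl
  catMaybes-map-just (x ∷ L) = cong (x ∷_) (catMaybes-map-just L)

  full-map-just : ∀ (L : List ℕ) → full (map just L) ≡ true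
  full-map-just []      = refl
  full-map-just (x ∷ L) = full-map-just L

  catMaybes-replicate-++ : ∀ g (X : Spots) → catMaybes (replicate g nothing ++ X) ≡ catMaybes X
  catMaybes-replicate-++ zero    X = refl
  catMaybes-replicate-++ (suc g) X = catMaybes-replicate-++ g X

  holes-map-just-++ : ∀ L (X : Spots) → holes (map just L ++ X) ≡ holes X
  holes-map-just-++ []      X = refl
  holes-map-just-++ (x ∷ L) X = holes-map-just-++ L X

  holes-replicate-++ : ∀ g (X : Spots) → holes (replicate g nothing ++ X) ≡ g + holes X
  holes-replicate-++ zero    X = refl
  holes-replicate-++ (suc g) X = cong suc (holes-replicate-++ g X)

  holes-replicate : ∀ r → holes (replicate r nothing) ≡ r
  holes-replicate zero    = refl
  holes-replicate (suc r) = cong suc (holes-replicate r)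

  length-++-[x] : ∀ (L : List ℕ) x → length (L ++ x ∷ []) ≡ suc (length L)
  length-++-[x] L x = trans (length-++ L) (+-comm (length L) 1)

  length-++-[x,y] : ∀ (L : List ℕ) x y → length (L ++ x ∷ y ∷ []) ≡ suc (suc (length L))
  length-++-[x,y] L x y = trans (length-++ L) (+-comm (length L) 2)

  filledState : List ℕ → ℕ → Spots
  filledState L r = map just L ++ replicate r nothing

  gappedState : List ℕ → ℕ → ℕ → ℕ → Spots
  gappedState L g d r = map just L ++ nothing ∷ (replicate g nothing ++ just d ∷ replicate r nothing)

  module Counts (n : ℕ) where
    FilledCount : ℕ → Set
    FilledCount r = ∀ L c → All (_< c) L → ¬ BadTriple L → n ≡ length L + r →
                    goodRuns n (filledState L r) c r ≡ closedSuffix (length L) r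

    GappedCount : ℕ → ℕ → Set
    GappedCount g r = ∀ L d c → All (_< c) L → d < c → ¬ BadTriple (L ++ d ∷ []) →
                      n ≡ length L + (suc g + suc r) →
                      goodRuns n (gappedState L g d r) c (suc g + r) ≡ gappedSuffix (length L) g r

    All-<-suc : ∀ {L c} → All (_< c) L → All (_< suc c) L
    All-<-suc = All.map m<n⇒m<1+n

    filledCount-0 : FilledCount 0
    filledCount-0 L c _ good _
      rewrite ++-identityʳ (map just L) | full-map-just L | catMaybes-map-just L | avoidsAll-good L good = refl

    -- The car either does not park, leaving more holes than cars, or becomes a second
    -- car after the gap.
    gappedCount-pastGap : ∀ g r L d c → d < c → ∀ i →
      goodRuns n (placeFrom c (suc (length L + i)) (gappedState L g d r)) (suc c) (g + r) ≡ 0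
    gappedCount-pastGap g r L d c d<c i rewrite placeFrom-beyond c i L (replicate g nothing ++ just d ∷ replicate r nothing)
      with placeFrom-beside c i (replicate g nothing ++ just d ∷ replicate r nothing) d
             (subst (d ∷ [] ⊆_) (sym (catMaybes-replicate-++ g (just d ∷ replicate r nothing))) (refl ∷ minimum _))
    ... | inj₁ unchanged rewrite unchanged = goodRuns-fewCars n (g + r) _ (suc c) tooFew
      where
      tooFew : g + r < holes (gappedState L g d r)
      tooFew rewrite holes-map-just-++ L (nothing ∷ (replicate g nothing ++ just d ∷ replicate r nothing))
                   | holes-replicate-++ g (just d ∷ replicate r nothing) | holes-replicate r = ≤-refl
    ... | inj₂ (inj₁ c,d) =
      goodRuns-holeBeforePair n (g + r) (map just L) _ (suc c) c,d (n<1+n c) (m<n⇒m<1+n d<c) (≢-sym (<⇒≢ d<c))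
    ... | inj₂ (inj₂ d,c) =
      goodRuns-holeBeforePair n (g + r) (map just L) _ (suc c) d,c (m<n⇒m<1+n d<c) (n<1+n c) (<⇒≢ d<c)

    gappedCount : ∀ r → FilledCount r → ∀ g → GappedCount g r
    gappedCount r filled zero L d c L<c d<c good n≡ =
      trans (∑-constPrefix (suc p) (suc r) _ (λ _ → 0) (trans n≡ (+-suc p (suc r))) fillGap
                           (λ i _ → gappedCount-pastGap 0 r L d c d<c i))
            (trans (cong (suc p * closedSuffix (suc (suc p)) r +_) (∑-zero (suc r) (λ _ _ → refl))) (+-identityʳ _))
      where
      p = length L
      L′ = L ++ c ∷ d ∷ []
      fillGap : ∀ s → s < suc p →
                goodRuns n (placeFrom c s (gappedState L 0 d r)) (suc c) r ≡ closedSuffix (suc (suc p)) r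
      fillGap s s≤p = begin
          goodRuns n (placeFrom c s (gappedState L 0 d r)) (suc c) r
        ≡⟨ cong (λ st → goodRuns n st (suc c) r)
                (trans (placeFrom-filled c s L _ (≤-pred s≤p))
                       (sym (map-just-++ L (c ∷ d ∷ []) (replicate r nothing)))) ⟩
          goodRuns n (filledState L′ r) (suc c) r
        ≡⟨ filled L′ (suc c) (All-++⁺ (All-<-suc L<c) (n<1+n c ∷ m<n⇒m<1+n d<c ∷ []))
                  (λ bad → good (BadTriple-dropMax L c (d ∷ []) L<c (s≤s z≤n) bad))
                  (trans n≡ (trans (+-suc p (suc r)) (trans (cong suc (+-suc p r))
                                   (cong (_+ r) (sym (length-++-[x,y] L c d)))))) ⟩
          closedSuffix (length L′) r
        ≡⟨ cong (λ l → closedSuffix l r) (length-++-[x,y] L c d) ⟩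
          closedSuffix (suc (suc p)) r ∎
        where open ≡-Reasoning
    gappedCount r filled (suc g) L d c L<c d<c good n≡ =
      trans (∑-constPrefix (suc p) (suc g + suc r) _ (λ _ → 0) (trans n≡ (+-suc p (suc g + suc r))) fillGap
                           (λ i _ → gappedCount-pastGap (suc g) r L d c d<c i))
            (trans (cong (suc p * gappedSuffix (suc p) g r +_) (∑-zero (suc g + suc r) (λ _ _ → refl))) (+-identityʳ _))
      where
      p = length L
      L′ = L ++ c ∷ []
      fillGap : ∀ s → s < suc p →
                goodRuns n (placeFrom c s (gappedState L (suc g) d r)) (suc c) (suc g + r) ≡ gappedSuffix (suc p) g r
      fillGap s s≤p = begin
          goodRuns n (placeFrom c s (gappedState L (suc g) d r)) (suc c) (suc g + r)
        ≡⟨ cong (λ st → goodRuns n st (suc c) (suc g + r))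
                (trans (placeFrom-filled c s L _ (≤-pred s≤p)) (sym (map-just-++ L (c ∷ []) _))) ⟩
          goodRuns n (gappedState L′ g d r) (suc c) (suc g + r)
        ≡⟨ gappedCount r filled g L′ d (suc c) (All-++⁺ (All-<-suc L<c) (n<1+n c ∷ [])) (m<n⇒m<1+n d<c)
             (λ bad → good (BadTriple-dropMax L c (d ∷ []) L<c (s≤s z≤n)
                                              (subst BadTriple (++-assoc L (c ∷ []) (d ∷ [])) bad)))
             (trans n≡ (trans (+-suc p (suc g + suc r)) (cong (_+ (suc g + suc r)) (sym (length-++-[x] L c))))) ⟩
          gappedSuffix (length L′) g r
        ≡⟨ cong (λ l → gappedSuffix l g r) (length-++-[x] L c) ⟩
          gappedSuffix (suc p) g r ∎
        where open ≡-Reasoning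

    filledCount-suc : ∀ r → (∀ {r′} → r′ < suc r → FilledCount r′) → FilledCount (suc r)
    filledCount-suc r filled L c L<c good n≡ =
      trans (∑-constPrefix (suc p) r _ (λ j → gappedSuffix p j (r ∸ suc j)) (trans n≡ (+-suc p r)) fillNext jump)
            (cong (suc p * closedSuffix (suc p) r +_) (∑-gappedSuffix p r))
      where
      p = length L
      good′ : ¬ BadTriple (L ++ c ∷ [])
      good′ bad = good (subst BadTriple (++-identityʳ L) (BadTriple-dropMax L c [] L<c z≤n bad))
      fillNext : ∀ s → s < suc p → goodRuns n (placeFrom c s (filledState L (suc r))) (suc c) r ≡ closedSuffix (suc p) r
      fillNext s s≤p = begin
          goodRuns n (placeFrom c s (filledState L (suc r))) (suc c) r
        ≡⟨ cong (λ st → goodRuns n st (suc c) r)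
                (trans (placeFrom-filled c s L _ (≤-pred s≤p)) (sym (map-just-++ L (c ∷ []) (replicate r nothing)))) ⟩
          goodRuns n (filledState (L ++ c ∷ []) r) (suc c) r
        ≡⟨ filled ≤-refl (L ++ c ∷ []) (suc c) (All-++⁺ (All-<-suc L<c) (n<1+n c ∷ [])) good′
                  (trans n≡ (trans (+-suc p r) (cong (_+ r) (sym (length-++-[x] L c))))) ⟩
          closedSuffix (length (L ++ c ∷ [])) r
        ≡⟨ cong (λ l → closedSuffix l r) (length-++-[x] L c) ⟩
          closedSuffix (suc p) r ∎
        where open ≡-Reasoning
      jump : ∀ j → j < r →
             goodRuns n (placeFrom c (suc p + j) (filledState L (suc r))) (suc c) r ≡ gappedSuffix p j (r ∸ suc j)
      jump j j<r = begin
          goodRuns n (placeFrom c (suc p + j) (filledState L (suc r))) (suc c) r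
        ≡⟨ cong (λ st → goodRuns n st (suc c) r)
                (trans (placeFrom-beyond c j L (replicate r nothing))
                       (cong (λ R → map just L ++ nothing ∷ R) (placeFrom-replicate c j r j<r))) ⟩
          goodRuns n (gappedState L j c (r ∸ suc j)) (suc c) r
        ≡⟨ cong (goodRuns n (gappedState L j c (r ∸ suc j)) (suc c)) (sym (m+[n∸m]≡n j<r)) ⟩
          goodRuns n (gappedState L j c (r ∸ suc j)) (suc c) (suc j + (r ∸ suc j))
        ≡⟨ gappedCount (r ∸ suc j) (filled (s≤s (m∸n≤m r (suc j)))) j L c (suc c) (All-<-suc L<c) (n<1+n c) good′
             (trans n≡ (cong (p +_) (sym (trans (+-suc (suc j) (r ∸ suc j)) (cong suc (m+[n∸m]≡n j<r)))))) ⟩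
          gappedSuffix p j (r ∸ suc j) ∎
        where open ≡-Reasoning

    filledCount : ∀ r → FilledCount r
    filledCount = <-rec FilledCount λ where
      zero    _      → filledCount-0
      (suc r) filled → filledCount-suc r filled

  goodRuns-emptySpots : ∀ n → goodRuns n (emptySpots n) 1 n ≡ closedPrefix n
  goodRuns-emptySpots n = begin
      goodRuns n (emptySpots n) 1 n      ≡⟨ cong (λ st → goodRuns n st 1 n) (emptySpots≡replicate n) ⟩
      goodRuns n (filledState [] n) 1 n  ≡⟨ Counts.filledCount n n [] 1 [] noBadTriple refl ⟩
      closedSuffix 0 n                   ≡⟨ closedSuffix-from-0 n ⟩
      closedPrefix n                     ∎
    where
    open ≡-Reasoning
    emptySpots≡replicate : ∀ n → emptySpots n ≡ replicate n nothing
    emptySpots≡replicate zero    = refl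
    emptySpots≡replicate (suc n) = cong (nothing ∷_) (emptySpots≡replicate n)
    noBadTriple : ¬ BadTriple []
    noBadTriple (badTriple () _ _ _)

module Enumeration where
  open import Defs using (allVecs; allFuns; pk; isParking; avoidsAll; parkingPerm; emptySpots; placeFrom)
  open import Data.Nat using (ℕ; zero; suc; _+_)
  open import Data.Nat.Properties using (+-assoc; +-identityʳ)
  open import Data.Nat.ListAction using (sum)
  open import Data.Fin as Fin using (Fin; toℕ)
  open import Data.Bool using (Bool; true; false; _∧_)
  open import Data.Bool.Properties using () renaming (_≟_ to _≟ᵇ_)
  open import Data.List using (List; []; _∷_; _++_; map; concatMap; length; filter; tabulate; allFin)
  open import Data.List.Properties using (map-tabulate)
  open import Data.Vec as Vec using (Vec; toList)
  open import Relation.Binary.PropositionalEquality using (_≡_; refl; sym; trans; cong; cong₂; module ≡-Reasoning)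
  open BoundedSums
  open Patterns using (forbidden)
  open ParkingProcess
  open ParkingCriterion using (isParking≡full)
  open Transfer using (good; indicator; goodRuns; goodRuns-emptySpots)
  open Weights using (closedPrefix)

  count : ∀ {A : Set} → (A → Bool) → List A → ℕ
  count p []       = 0
  count p (x ∷ xs) = indicator (p x) + count p xs

  length-filter≡count : ∀ {A : Set} (p : A → Bool) xs → length (filter (λ x → p x ≟ᵇ true) xs) ≡ count p xs
  length-filter≡count p []       = refl
  length-filter≡count p (x ∷ xs) with p x
  ... | true  = cong suc (length-filter≡count p xs)
  ... | false = length-filter≡count p xs

  count-cong : ∀ {A : Set} {p q : A → Bool} xs → (∀ x → p x ≡ q x) → count p xs ≡ count q xs
  count-cong []       p≗q = refl
  count-cong (x ∷ xs) p≗q = cong₂ _+_ (cong indicator (p≗q x)) (count-cong xs p≗q)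

  count-++ : ∀ {A : Set} (p : A → Bool) xs ys → count p (xs ++ ys) ≡ count p xs + count p ys
  count-++ p []       ys = refl
  count-++ p (x ∷ xs) ys = trans (cong (indicator (p x) +_) (count-++ p xs ys)) (sym (+-assoc (indicator (p x)) _ _))

  count-concatMap : ∀ {A B : Set} (p : B → Bool) (f : A → List B) xs →
                    count p (concatMap f xs) ≡ sum (map (λ x → count p (f x)) xs)
  count-concatMap p f []       = refl
  count-concatMap p f (x ∷ xs) = trans (count-++ p (f x) (concatMap f xs)) (cong (count p (f x) +_) (count-concatMap p f xs))

  count-map : ∀ {A B : Set} (p : B → Bool) (f : A → B) xs → count p (map f xs) ≡ count (λ x → p (f x)) xs
  count-map p f []       = refl
  count-map p f (x ∷ xs) = cong (indicator (p (f x)) +_) (count-map p f xs)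

  sum-tabulate : ∀ m (f : Fin m → ℕ) (g : ℕ → ℕ) → (∀ i → f i ≡ g (toℕ i)) →
                 sum (tabulate f) ≡ ∑[ i < m ] g i
  sum-tabulate zero    f g f≗g = refl
  sum-tabulate (suc m) f g f≗g =
    cong₂ _+_ (f≗g Fin.zero) (sum-tabulate m (λ i → f (Fin.suc i)) (λ i → g (suc i)) (λ i → f≗g (Fin.suc i)))

  count-allVecs : ∀ n k st c →
    count (λ (v : Vec (Fin n) k) → good (runFrom st c (toList v))) (allVecs k (allFin n)) ≡ goodRuns n st c k
  count-allVecs n zero    st c = +-identityʳ _
  count-allVecs n (suc k) st c = begin
      count goodRun (concatMap (λ x → map (x Vec.∷_) (allVecs k (allFin n))) (allFin n))
    ≡⟨ count-concatMap goodRun _ (allFin n) ⟩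
      sum (map (λ x → count goodRun (map (x Vec.∷_) (allVecs k (allFin n)))) (allFin n))
    ≡⟨ cong sum (map-tabulate (λ x → x) extend) ⟩
      sum (tabulate (λ x → count goodRun (map (x Vec.∷_) (allVecs k (allFin n)))))
    ≡⟨ sum-tabulate n extend (λ s → goodRuns n (placeFrom c s st) (suc c) k) after ⟩
      ∑[ s < n ] goodRuns n (placeFrom c s st) (suc c) k ∎
    where
    open ≡-Reasoning
    goodRun : Vec (Fin n) (suc k) → Bool
    goodRun v = good (runFrom st c (toList v))
    extend : Fin n → ℕ
    extend x = count goodRun (map (x Vec.∷_) (allVecs k (allFin n)))
    after : ∀ x → extend x ≡ goodRuns n (placeFrom c (toℕ x) st) (suc c) k
    after x = trans (count-map goodRun (x Vec.∷_) (allVecs k (allFin n)))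
                    (count-allVecs n k (placeFrom c (toℕ x) st) (suc c))

  pk≡goodRuns : ∀ n → pk n forbidden ≡ goodRuns n (emptySpots n) 1 n
  pk≡goodRuns n = begin
      pk n forbidden
    ≡⟨ length-filter≡count _ (allFuns n) ⟩
      count (λ f → isParking f ∧ avoidsAll (parkingPerm f) forbidden) (allFuns n)
    ≡⟨ count-cong (allFuns n) byRunning ⟩
      count (λ f → good (runFrom (emptySpots n) 1 (toList f))) (allFuns n)
    ≡⟨ count-allVecs n n (emptySpots n) 1 ⟩
      goodRuns n (emptySpots n) 1 n ∎
    where
    open ≡-Reasoning
    byRunning : ∀ (f : Vec (Fin n) n) →
                isParking f ∧ avoidsAll (parkingPerm f) forbidden ≡ good (runFrom (emptySpots n) 1 (toList f))
    byRunning f rewrite isParking≡full f | parkingOutcome≡runFrom f = refl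

  pk-forbidden≡closedPrefix : ∀ n → pk n forbidden ≡ closedPrefix n
  pk-forbidden≡closedPrefix n = trans (pk≡goodRuns n) (goodRuns-emptySpots n)

open import Defs
open import Data.Nat using (ℕ; suc; _∸_; _≤_)
open import Data.Nat.Combinatorics using (_C_)
open import Data.Nat.Properties using (_!≢0)
open import Data.Nat.Base using (_!)
open import Data.Integer using (+_)
open import Data.Rational using (_/_; _+_; _*_; 0ℚ)
open import Data.List using ([]; _∷_; foldr; map; upTo)
open import Relation.Binary.PropositionalEquality using (_≡_; trans; cong)
open Enumeration using (pk-forbidden≡closedPrefix)
open RationalSums using (closedPrefix-Lah)

mainTheorem18 : (n : ℕ) → 1 ≤ n →
    (+ pk n ((3 ∷ 1 ∷ 2 ∷ []) ∷ (3 ∷ 2 ∷ 1 ∷ []) ∷ [])) / 1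
      ≡ ((+ (n !)) / 1) * foldr _+_ 0ℚ
          (map (λ i → _/_ (+ ((n ∸ 1) C i)) (suc i !) {{suc i !≢0}}) (upTo n))
mainTheorem18 (suc m) _ = trans (cong (λ k → (+ k) / 1) (pk-forbidden≡closedPrefix (suc m))) (closedPrefix-Lah m)
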